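{- If $\vdash M : C$ is a closed computation term of $\lambda_{\mathrm{eff}}$, then either $M$ is a normal form, or there exists a computation term $N$ such that $M \leadsto N$ and $\vdash N : C$. Here, normal forms are computation terms of the form (a) $\mathtt{return}\ V$, (b) $E[\mathtt{op}(V)]$ where $E$ does not contain handle-with, or (c) $E[(\pi_i\,V)\,W]$ where $E$ may contain handle-with.
   Context: $\lambda_{\mathrm{eff}}$: value types $A::=A\to C\mid\prod_{i=1}^nA_i$; computation types $C::=A!\Sigma$; signatures $\Sigma$ are finite sets of entries $\mathtt{op}:A\to B$ (operation $\mathtt{op}$ with argument type $A$ and result type $B$; this arrow denotes an operation signature, not a function type); handler types $\Sigma\Rightarrow C$. Values $V::=x\mid\lambda x.M\mid\langle V_1,\dots,V_n\rangle\mid\pi_iV$; computations $M::=V\,W\mid\mathtt{return}\ V\mid\mathtt{let}\ x\Leftarrow M\ \mathtt{in}\ N\mid\mathtt{op}(V)\mid\mathtt{handle}\ M\ \mathtt{with}\ H\ \mathtt{to}\ x.N$; handlers $H::=\emptyset\mid\{\mathtt{op}(x,k)\mapsto M\}\cup H$. Typing: $\mathtt{op}(V):B!\Sigma$ if $(\mathtt{op}:A\to B)\in\Sigma$ and $V:A$; $\mathtt{let}$ requires both computations to have the same $\Sigma$; $H:\Sigma\Rightarrow C$ has a clause $\Gamma,x:A_{\mathtt{op}},k:B_{\mathtt{op}}\to C\vdash M_{\mathtt{op}}:C$ for each $(\mathtt{op}:A_{\mathtt{op}}\to B_{\mathtt{op}})\in\Sigma$; $\mathtt{handle}\ M\ \mathtt{with}\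 H\ \mathtt{to}\ x.N:C$ if $M:A!\Sigma$, $H:\Sigma\Rightarrow C$, $\Gamma,x:A\vdash N:C$. The reduction $\leadsto$ on closed computations: evaluation contexts $E::=[\,]\mid\mathtt{let}\ x\Leftarrow E\ \mathtt{in}\ N\mid\mathtt{handle}\ E\ \mathtt{with}\ H\ \mathtt{to}\ x.M$; $E[M]\leadsto E[N]$ if $M\leadsto N$; $\mathtt{let}\ x\Leftarrow\mathtt{return}\ V\ \mathtt{in}\ M\leadsto M[V/x]$; $(\lambda x.M)V\leadsto M[V/x]$; $\mathtt{handle}\ \mathtt{return}\ V\ \mathtt{with}\ H\ \mathtt{to}\ x.M\leadsto M[V/x]$; $\mathtt{handle}\ E[\mathtt{op}(V)]\ \mathtt{with}\ H\ \mathtt{to}\ x.M\leadsto M_{\mathtt{op}}[V/x,\lambda y.\mathtt{handle}\ E[\mathtt{return}\ y]\ \mathtt{with}\ H\ \mathtt{to}\ x.M/k]$ if $E$ does not contain handle-with, where $(\mathtt{op}(x,k)\mapsto M_{\mathtt{op}})\in H$. There is no reduction rule for projections of tuples. -}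

module Defs where

open import Data.Nat using (ℕ; zero; suc)
open import Data.Fin using (Fin; zero; suc; toℕ)
open import Data.List using (List; []; _∷_; length; lookup)
open import Data.List.Membership.Propositional using (_∈_)
open import Data.Vec using (Vec)
import Data.Vec as Vec
open import Data.Product using (Σ; _×_; _,_; ∃)
open import Data.Sum using (_⊎_)
open import Relation.Binary.PropositionalEquality using (_≡_)

Op : Set
Op = ℕ

mutual
  data VType : Set where
    _⇒_  : VType → CType → VType
    prod : List VType → VType

  data CType : Set where
    _!_ : VType → List Entry → CType

  data Entry : Set where
    entry : Op → VType → VType → Entry

Sig : Set
Sig = List Entry

-- Well-scoped syntax (de Bruijn, indexed by the number of free variables)

mutual
  data Val (n : ℕ) : Set where
    var  : Fin n → Val n
    lam  : Comp (suc n) → Val n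
    tup  : Vals n → Val n
    proj : ℕ → Val n → Val n             -- π_i V  (0-based index i)

  data Vals (n : ℕ) : Set where
    []  : Vals n
    _∷_ : Val n → Vals n → Vals n

  data Comp (n : ℕ) : Set where
    app    : Val n → Val n → Comp n
    ret    : Val n → Comp n
    let'   : Comp n → Comp (suc n) → Comp n
    op     : Op → Val n → Comp n
    handle : Comp n → Handler n → Comp (suc n) → Comp n

  -- a handler is a collection of clauses op(x,k) ↦ M;
  -- in M, variable 0 is k and variable 1 is x
  data Handler (n : ℕ) : Set where
    ∅      : Handler n
    clause : Op → Comp (suc (suc n)) → Handler n → Handler n

Ren : ℕ → ℕ → Set
Ren n m = Fin n → Fin m

ext : ∀ {n m} → Ren n m → Ren (suc n) (suc m)
ext ρ zero    = zero
ext ρ (suc i) = suc (ρ i)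

mutual
  renV : ∀ {n m} → Ren n m → Val n → Val m
  renV ρ (var i)    = var (ρ i)
  renV ρ (lam M)    = lam (renC (ext ρ) M)
  renV ρ (tup Vs)   = tup (renVs ρ Vs)
  renV ρ (proj i V) = proj i (renV ρ V)

  renVs : ∀ {n m} → Ren n m → Vals n → Vals m
  renVs ρ []       = []
  renVs ρ (V ∷ Vs) = renV ρ V ∷ renVs ρ Vs

  renC : ∀ {n m} → Ren n m → Comp n → Comp m
  renC ρ (app V W)      = app (renV ρ V) (renV ρ W)
  renC ρ (ret V)        = ret (renV ρ V)
  renC ρ (let' M N)     = let' (renC ρ M) (renC (ext ρ) N)
  renC ρ (op o V)       = op o (renV ρ V)
  renC ρ (handle M H N) = handle (renC ρ M) (renH ρ H) (renC (ext ρ) N)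

  renH : ∀ {n m} → Ren n m → Handler n → Handler m
  renH ρ ∅              = ∅
  renH ρ (clause o M H) = clause o (renC (ext (ext ρ)) M) (renH ρ H)

Sub : ℕ → ℕ → Set
Sub n m = Fin n → Val m

exts : ∀ {n m} → Sub n m → Sub (suc n) (suc m)
exts σ zero    = var zero
exts σ (suc i) = renV suc (σ i)

mutual
  subV : ∀ {n m} → Sub n m → Val n → Val m
  subV σ (var i)    = σ i
  subV σ (lam M)    = lam (subC (exts σ) M)
  subV σ (tup Vs)   = tup (subVs σ Vs)
  subV σ (proj i V) = proj i (subV σ V)

  subVs : ∀ {n m} → Sub n m → Vals n → Vals m
  subVs σ []       = []
  subVs σ (V ∷ Vs) = subV σ V ∷ subVs σ Vs

  subC : ∀ {n m} → Sub n m → Comp n → Comp m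
  subC σ (app V W)      = app (subV σ V) (subV σ W)
  subC σ (ret V)        = ret (subV σ V)
  subC σ (let' M N)     = let' (subC σ M) (subC (exts σ) N)
  subC σ (op o V)       = op o (subV σ V)
  subC σ (handle M H N) = handle (subC σ M) (subH σ H) (subC (exts σ) N)

  subH : ∀ {n m} → Sub n m → Handler n → Handler m
  subH σ ∅              = ∅
  subH σ (clause o M H) = clause o (subC (exts (exts σ)) M) (subH σ H)

_[_] : ∀ {n} → Comp (suc n) → Val n → Comp n
M [ V ] = subC σ M
  where
  σ : Sub _ _
  σ zero    = V
  σ (suc i) = var i

_[_//_] : ∀ {n} → Comp (suc (suc n)) → Val n → Val n → Comp n
M [ V // K ] = subC σ M
  where
  σ : Sub _ _
  σ zero          = K
  σ (suc zero)    = V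
  σ (suc (suc i)) = var i

data EC (n : ℕ) : Set where
  hole    : EC n
  letE    : EC n → Comp (suc n) → EC n
  handleE : EC n → Handler n → Comp (suc n) → EC n

plug : ∀ {n} → EC n → Comp n → Comp n
plug hole            M = M
plug (letE E N)      M = let' (plug E M) N
plug (handleE E H N) M = handle (plug E M) H N

renE : ∀ {n m} → Ren n m → EC n → EC m
renE ρ hole            = hole
renE ρ (letE E N)      = letE (renE ρ E) (renC (ext ρ) N)
renE ρ (handleE E H N) = handleE (renE ρ E) (renH ρ H) (renC (ext ρ) N)

data HandleFree {n : ℕ} : EC n → Set where
  hole : HandleFree hole
  letE : ∀ {E N} → HandleFree E → HandleFree (letE E N)

data HasClause {n : ℕ} : Handler n → Op → Comp (suc (suc n)) → Set where
  here  : ∀ {o M H} → HasClause (clause o M H) o M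
  there : ∀ {o M o′ M′ H} → HasClause H o M → HasClause (clause o′ M′ H) o M

infix 4 _⇝_
data _⇝_ : Comp 0 → Comp 0 → Set where
  ctx        : ∀ (E : EC 0) {M N} → M ⇝ N → plug E M ⇝ plug E N
  let-ret    : ∀ {V M} → let' (ret V) M ⇝ M [ V ]
  app-lam    : ∀ {M V} → app (lam M) V ⇝ M [ V ]
  handle-ret : ∀ {V H M} → handle (ret V) H M ⇝ M [ V ]
  handle-op  : ∀ {E o V H M Mop} → HandleFree E → HasClause H o Mop →
               handle (plug E (op o V)) H M ⇝
                 Mop [ V // lam (handle (plug (renE suc E) (ret (var zero)))
                                       (renH suc H) (renC (ext suc) M)) ]

Ctx : ℕ → Set
Ctx n = Vec VType n

mutual
  data _⊢v_∶_ {n : ℕ} (Γ : Ctx n) : Val n → VType → Set where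
    var  : ∀ i → Γ ⊢v var i ∶ Vec.lookup Γ i
    lam  : ∀ {A C M} → (A Vec.∷ Γ) ⊢c M ∶ C → Γ ⊢v lam M ∶ (A ⇒ C)
    tup  : ∀ {Vs As} → Γ ⊢vs Vs ∶ As → Γ ⊢v tup Vs ∶ prod As
    proj : ∀ {V As} → Γ ⊢v V ∶ prod As → (i : Fin (length As)) →
           Γ ⊢v proj (toℕ i) V ∶ lookup As i

  data _⊢vs_∶_ {n : ℕ} (Γ : Ctx n) : Vals n → List VType → Set where
    []  : Γ ⊢vs [] ∶ []
    _∷_ : ∀ {V Vs A As} → Γ ⊢v V ∶ A → Γ ⊢vs Vs ∶ As → Γ ⊢vs (V ∷ Vs) ∶ (A ∷ As)

  data _⊢c_∶_ {n : ℕ} (Γ : Ctx n) : Comp n → CType → Set where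
    app    : ∀ {V W A C} → Γ ⊢v V ∶ (A ⇒ C) → Γ ⊢v W ∶ A → Γ ⊢c app V W ∶ C
    ret    : ∀ {V A Σ′} → Γ ⊢v V ∶ A → Γ ⊢c ret V ∶ (A ! Σ′)
    let'   : ∀ {M N A B Σ′} → Γ ⊢c M ∶ (A ! Σ′) → (A Vec.∷ Γ) ⊢c N ∶ (B ! Σ′) →
             Γ ⊢c let' M N ∶ (B ! Σ′)
    op     : ∀ {o V A B Σ′} → entry o A B ∈ Σ′ → Γ ⊢v V ∶ A → Γ ⊢c op o V ∶ (B ! Σ′)
    handle : ∀ {M H N A Σ′ C} → Γ ⊢c M ∶ (A ! Σ′) → Γ ⊢h H ∶ Σ′ ⇛ C →
             (A Vec.∷ Γ) ⊢c N ∶ C → Γ ⊢c handle M H N ∶ C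

  data _⊢h_∶_⇛_ {n : ℕ} (Γ : Ctx n) : Handler n → Sig → CType → Set where
    handler : ∀ {H Σ′ C} →
      (∀ {o A B} → entry o A B ∈ Σ′ →
         Σ (Comp (suc (suc n))) λ M → HasClause H o M × ((B ⇒ C) Vec.∷ A Vec.∷ Γ) ⊢c M ∶ C) →
      Γ ⊢h H ∶ Σ′ ⇛ C

data Normal : Comp 0 → Set where
  ret-nf  : ∀ V → Normal (ret V)
  op-nf   : ∀ E o V → HandleFree E → Normal (plug E (op o V))
  proj-nf : ∀ E i V W → Normal (plug E (app (proj i V) W))

{-# OPTIONS --safe #-}
-- The only delicate case is handling an operation: the handle-free context E
-- around op(V) keeps the effect signature unchanged, so op has a clause in the
-- enclosing handler, and the captured continuation is typed by re-plugging E.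
module Submission where

open import Defs
open import Data.Fin using (zero; suc)
open import Data.Nat using (ℕ; suc)
open import Data.Product using (Σ; _×_; _,_)
open import Data.Sum using (_⊎_; inj₁; inj₂)
open import Data.Vec using ([]; _∷_; lookup)
open import Relation.Binary.PropositionalEquality using (_≡_; refl; subst)

private
  variable
    n m : ℕ
    Γ Δ : Ctx n
    A B : VType
    C D : CType
    S S′ : Sig
    E : EC n
    H : Handler n
    M N : Comp n
    V W K : Val n
    o : Op

_⊢ʳ_∶_ : Ctx m → Ren n m → Ctx n → Set
Δ ⊢ʳ ρ ∶ Γ = ∀ i → lookup Δ (ρ i) ≡ lookup Γ i

ext-⊢ʳ : ∀ {ρ : Ren n m} → Δ ⊢ʳ ρ ∶ Γ → (A ∷ Δ) ⊢ʳ ext ρ ∶ (A ∷ Γ)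
ext-⊢ʳ ρ⊢ zero    = refl
ext-⊢ʳ ρ⊢ (suc i) = ρ⊢ i

renH-HasClause : ∀ {ρ : Ren n m} {Mop} → HasClause H o Mop →
  HasClause (renH ρ H) o (renC (ext (ext ρ)) Mop)
renH-HasClause here      = here
renH-HasClause (there c) = there (renH-HasClause c)

mutual
  ⊢v-ren : ∀ {ρ : Ren n m} → Δ ⊢ʳ ρ ∶ Γ → Γ ⊢v V ∶ A → Δ ⊢v renV ρ V ∶ A
  ⊢v-ren {Δ = Δ} {ρ = ρ} ρ⊢ (var i) = subst (Δ ⊢v var (ρ i) ∶_) (ρ⊢ i) (var (ρ i))
  ⊢v-ren ρ⊢ (lam ⊢M)    = lam (⊢c-ren (ext-⊢ʳ ρ⊢) ⊢M)
  ⊢v-ren ρ⊢ (tup ⊢Vs)   = tup (⊢vs-ren ρ⊢ ⊢Vs)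
  ⊢v-ren ρ⊢ (proj ⊢V i) = proj (⊢v-ren ρ⊢ ⊢V) i

  ⊢vs-ren : ∀ {ρ : Ren n m} {Vs As} → Δ ⊢ʳ ρ ∶ Γ → Γ ⊢vs Vs ∶ As → Δ ⊢vs renVs ρ Vs ∶ As
  ⊢vs-ren ρ⊢ []         = []
  ⊢vs-ren ρ⊢ (⊢V ∷ ⊢Vs) = ⊢v-ren ρ⊢ ⊢V ∷ ⊢vs-ren ρ⊢ ⊢Vs

  ⊢c-ren : ∀ {ρ : Ren n m} → Δ ⊢ʳ ρ ∶ Γ → Γ ⊢c M ∶ C → Δ ⊢c renC ρ M ∶ C
  ⊢c-ren ρ⊢ (app ⊢V ⊢W)       = app (⊢v-ren ρ⊢ ⊢V) (⊢v-ren ρ⊢ ⊢W)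
  ⊢c-ren ρ⊢ (ret ⊢V)          = ret (⊢v-ren ρ⊢ ⊢V)
  ⊢c-ren ρ⊢ (let' ⊢M ⊢N)      = let' (⊢c-ren ρ⊢ ⊢M) (⊢c-ren (ext-⊢ʳ ρ⊢) ⊢N)
  ⊢c-ren ρ⊢ (op e ⊢V)         = op e (⊢v-ren ρ⊢ ⊢V)
  ⊢c-ren ρ⊢ (handle ⊢M ⊢H ⊢N) = handle (⊢c-ren ρ⊢ ⊢M) (⊢h-ren ρ⊢ ⊢H) (⊢c-ren (ext-⊢ʳ ρ⊢) ⊢N)

  ⊢h-ren : ∀ {ρ : Ren n m} → Δ ⊢ʳ ρ ∶ Γ → Γ ⊢h H ∶ S ⇛ C → Δ ⊢h renH ρ H ∶ S ⇛ C
  ⊢h-ren ρ⊢ (handler clauses) =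
    handler λ e → let (Mop , c , ⊢Mop) = clauses e in
      _ , renH-HasClause c , ⊢c-ren (ext-⊢ʳ (ext-⊢ʳ ρ⊢)) ⊢Mop

_⊢ˢ_∶_ : Ctx m → Sub n m → Ctx n → Set
Δ ⊢ˢ σ ∶ Γ = ∀ i → Δ ⊢v σ i ∶ lookup Γ i

exts-⊢ˢ : ∀ {σ : Sub n m} → Δ ⊢ˢ σ ∶ Γ → (A ∷ Δ) ⊢ˢ exts σ ∶ (A ∷ Γ)
exts-⊢ˢ σ⊢ zero    = var zero
exts-⊢ˢ σ⊢ (suc i) = ⊢v-ren (λ _ → refl) (σ⊢ i)

subH-HasClause : ∀ {σ : Sub n m} {Mop} → HasClause H o Mop →
  HasClause (subH σ H) o (subC (exts (exts σ)) Mop)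
subH-HasClause here      = here
subH-HasClause (there c) = there (subH-HasClause c)

mutual
  ⊢v-sub : ∀ {σ : Sub n m} → Δ ⊢ˢ σ ∶ Γ → Γ ⊢v V ∶ A → Δ ⊢v subV σ V ∶ A
  ⊢v-sub σ⊢ (var i)     = σ⊢ i
  ⊢v-sub σ⊢ (lam ⊢M)    = lam (⊢c-sub (exts-⊢ˢ σ⊢) ⊢M)
  ⊢v-sub σ⊢ (tup ⊢Vs)   = tup (⊢vs-sub σ⊢ ⊢Vs)
  ⊢v-sub σ⊢ (proj ⊢V i) = proj (⊢v-sub σ⊢ ⊢V) i

  ⊢vs-sub : ∀ {σ : Sub n m} {Vs As} → Δ ⊢ˢ σ ∶ Γ → Γ ⊢vs Vs ∶ As → Δ ⊢vs subVs σ Vs ∶ As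
  ⊢vs-sub σ⊢ []         = []
  ⊢vs-sub σ⊢ (⊢V ∷ ⊢Vs) = ⊢v-sub σ⊢ ⊢V ∷ ⊢vs-sub σ⊢ ⊢Vs

  ⊢c-sub : ∀ {σ : Sub n m} → Δ ⊢ˢ σ ∶ Γ → Γ ⊢c M ∶ C → Δ ⊢c subC σ M ∶ C
  ⊢c-sub σ⊢ (app ⊢V ⊢W)       = app (⊢v-sub σ⊢ ⊢V) (⊢v-sub σ⊢ ⊢W)
  ⊢c-sub σ⊢ (ret ⊢V)          = ret (⊢v-sub σ⊢ ⊢V)
  ⊢c-sub σ⊢ (let' ⊢M ⊢N)      = let' (⊢c-sub σ⊢ ⊢M) (⊢c-sub (exts-⊢ˢ σ⊢) ⊢N)
  ⊢c-sub σ⊢ (op e ⊢V)         = op e (⊢v-sub σ⊢ ⊢V)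
  ⊢c-sub σ⊢ (handle ⊢M ⊢H ⊢N) = handle (⊢c-sub σ⊢ ⊢M) (⊢h-sub σ⊢ ⊢H) (⊢c-sub (exts-⊢ˢ σ⊢) ⊢N)

  ⊢h-sub : ∀ {σ : Sub n m} → Δ ⊢ˢ σ ∶ Γ → Γ ⊢h H ∶ S ⇛ C → Δ ⊢h subH σ H ∶ S ⇛ C
  ⊢h-sub σ⊢ (handler clauses) =
    handler λ e → let (Mop , c , ⊢Mop) = clauses e in
      _ , subH-HasClause c , ⊢c-sub (exts-⊢ˢ (exts-⊢ˢ σ⊢)) ⊢Mop

⊢c-[] : Γ ⊢v V ∶ A → (A ∷ Γ) ⊢c M ∶ C → Γ ⊢c M [ V ] ∶ C
⊢c-[] ⊢V = ⊢c-sub λ { zero → ⊢V ; (suc i) → var i }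

⊢c-[//] : Γ ⊢v V ∶ A → Γ ⊢v K ∶ B → (B ∷ A ∷ Γ) ⊢c M ∶ C → Γ ⊢c M [ V // K ] ∶ C
⊢c-[//] ⊢V ⊢K = ⊢c-sub λ { zero → ⊢K ; (suc zero) → ⊢V ; (suc (suc i)) → var i }

data _⊢e_∶_⊸_ (Γ : Ctx n) : EC n → CType → CType → Set where
  hole    : Γ ⊢e hole ∶ C ⊸ C
  letE    : ∀ {E N A B S} → Γ ⊢e E ∶ C ⊸ (A ! S) → (A ∷ Γ) ⊢c N ∶ (B ! S) →
            Γ ⊢e letE E N ∶ C ⊸ (B ! S)
  handleE : ∀ {E H N A S} → Γ ⊢e E ∶ C ⊸ (A ! S) → Γ ⊢h H ∶ S ⇛ D → (A ∷ Γ) ⊢c N ∶ D →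
            Γ ⊢e handleE E H N ∶ C ⊸ D

⊢c-plug : Γ ⊢e E ∶ C ⊸ D → Γ ⊢c M ∶ C → Γ ⊢c plug E M ∶ D
⊢c-plug hole               ⊢M = ⊢M
⊢c-plug (letE ⊢E ⊢N)       ⊢M = let' (⊢c-plug ⊢E ⊢M) ⊢N
⊢c-plug (handleE ⊢E ⊢H ⊢N) ⊢M = handle (⊢c-plug ⊢E ⊢M) ⊢H ⊢N

⊢c-plug⁻¹ : ∀ E → Γ ⊢c plug E M ∶ D → Σ CType λ C → Γ ⊢c M ∶ C × Γ ⊢e E ∶ C ⊸ D
⊢c-plug⁻¹ hole ⊢M = _ , ⊢M , hole
⊢c-plug⁻¹ (letE E N) (let' ⊢EM ⊢N) =
  let (C , ⊢M , ⊢E) = ⊢c-plug⁻¹ E ⊢EM in C , ⊢M , letE ⊢E ⊢N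
⊢c-plug⁻¹ (handleE E H N) (handle ⊢EM ⊢H ⊢N) =
  let (C , ⊢M , ⊢E) = ⊢c-plug⁻¹ E ⊢EM in C , ⊢M , handleE ⊢E ⊢H ⊢N

⊢e-ren : ∀ {ρ : Ren n m} → Δ ⊢ʳ ρ ∶ Γ → Γ ⊢e E ∶ C ⊸ D → Δ ⊢e renE ρ E ∶ C ⊸ D
⊢e-ren ρ⊢ hole               = hole
⊢e-ren ρ⊢ (letE ⊢E ⊢N)       = letE (⊢e-ren ρ⊢ ⊢E) (⊢c-ren (ext-⊢ʳ ρ⊢) ⊢N)
⊢e-ren ρ⊢ (handleE ⊢E ⊢H ⊢N) = handleE (⊢e-ren ρ⊢ ⊢E) (⊢h-ren ρ⊢ ⊢H) (⊢c-ren (ext-⊢ʳ ρ⊢) ⊢N)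

HandleFree-preserves-sig : HandleFree E → Γ ⊢e E ∶ (A ! S) ⊸ (B ! S′) → S ≡ S′
HandleFree-preserves-sig hole      hole         = refl
HandleFree-preserves-sig (letE hf) (letE ⊢E _)  = HandleFree-preserves-sig hf ⊢E

resume : EC n → Handler n → Comp (suc n) → Val n
resume E H N = lam (handle (plug (renE suc E) (ret (var zero))) (renH suc H) (renC (ext suc) N))

⊢v-resume : Γ ⊢e E ∶ (B ! S′) ⊸ (A ! S) → Γ ⊢h H ∶ S ⇛ C → (A ∷ Γ) ⊢c N ∶ C →
  Γ ⊢v resume E H N ∶ (B ⇒ C)
⊢v-resume ⊢E ⊢H ⊢N =
  lam (handle (⊢c-plug (⊢e-ren (λ _ → refl) ⊢E) (ret (var zero)))
              (⊢h-ren (λ _ → refl) ⊢H)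
              (⊢c-ren (ext-⊢ʳ (λ _ → refl)) ⊢N))

Progress : Comp 0 → CType → Set
Progress M C = Normal M ⊎ Σ (Comp 0) (λ N → (M ⇝ N) × ([] ⊢c N ∶ C))

app-progress : [] ⊢v V ∶ (A ⇒ C) → [] ⊢v W ∶ A → Progress (app V W) C
app-progress {V = var ()}
app-progress {V = lam M} {W = W} (lam ⊢M) ⊢W = inj₂ (M [ W ] , app-lam , ⊢c-[] ⊢W ⊢M)
app-progress {V = tup Vs} ()
app-progress {V = proj i V} {W = W} _ _ = inj₁ (proj-nf hole i V W)

let-progress : Progress M (A ! S) → [] ⊢c M ∶ (A ! S) → (A ∷ []) ⊢c N ∶ (B ! S) →
  Progress (let' M N) (B ! S)
let-progress (inj₁ (ret-nf V)) (ret ⊢V) ⊢N = inj₂ (_ , let-ret , ⊢c-[] ⊢V ⊢N)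
let-progress {N = N} (inj₁ (op-nf E o V hf)) _ _ = inj₁ (op-nf (letE E N) o V (letE hf))
let-progress {N = N} (inj₁ (proj-nf E i V W)) _ _ = inj₁ (proj-nf (letE E N) i V W)
let-progress {N = N} (inj₂ (M′ , M⇝M′ , ⊢M′)) _ ⊢N = inj₂ (_ , ctx (letE hole N) M⇝M′ , let' ⊢M′ ⊢N)

handle-progress : Progress M (A ! S) → [] ⊢c M ∶ (A ! S) → [] ⊢h H ∶ S ⇛ C → (A ∷ []) ⊢c N ∶ C →
  Progress (handle M H N) C
handle-progress (inj₁ (ret-nf V)) (ret ⊢V) _ ⊢N = inj₂ (_ , handle-ret , ⊢c-[] ⊢V ⊢N)
handle-progress (inj₁ (op-nf E o V hf)) ⊢EM ⊢H@(handler clauses) ⊢N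
  with ⊢c-plug⁻¹ E ⊢EM
... | _ , op e ⊢V , ⊢E with HandleFree-preserves-sig hf ⊢E
... | refl with clauses e
... | _ , c , ⊢Mop = inj₂ (_ , handle-op hf c , ⊢c-[//] ⊢V (⊢v-resume ⊢E ⊢H ⊢N) ⊢Mop)
handle-progress {H = H} {N = N} (inj₁ (proj-nf E i V W)) _ _ _ =
  inj₁ (proj-nf (handleE E H N) i V W)
handle-progress {H = H} {N = N} (inj₂ (M′ , M⇝M′ , ⊢M′)) _ ⊢H ⊢N =
  inj₂ (_ , ctx (handleE hole H N) M⇝M′ , handle ⊢M′ ⊢H ⊢N)

proposition3p2 : ∀ {M : Comp 0} {C : CType} → [] ⊢c M ∶ C →
    Normal M ⊎ Σ (Comp 0) (λ N → (M ⇝ N) × ([] ⊢c N ∶ C))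
proposition3p2 (app ⊢V ⊢W)             = app-progress ⊢V ⊢W
proposition3p2 (ret {V = V} _)          = inj₁ (ret-nf V)
proposition3p2 (op {o = o} {V = V} _ _) = inj₁ (op-nf hole o V hole)
proposition3p2 (let' ⊢M ⊢N)             = let-progress (proposition3p2 ⊢M) ⊢M ⊢N
proposition3p2 (handle ⊢M ⊢H ⊢N)        = handle-progress (proposition3p2 ⊢M) ⊢M ⊢H ⊢N
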